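{- Let $\Gamma$ be an $(m,n)$-regular graph with $m\ge 1$, and let $v\in V(\Gamma)$. Then the subgraph $\Gamma_1(v)$ of $\Gamma$ induced by the neighbours of $v$ and the subgraph $\Gamma_2(v)$ induced by the non-neighbours of $v$ other than $v$ are both $(m-1,n-1)$-regular.
   Context: Graphs are finite simple graphs; embeddings are injective maps preserving edges and non-edges. A graph-type is a triple $\mathbb{T}=(\Delta,\iota,\Theta)$ of graphs with an embedding $\iota:\Delta\hookrightarrow\Theta$; order $(|V(\Delta)|,|V(\Theta)|)$. $\Gamma$ is $\mathbb{T}$-regular if the number of embeddings $\hat\kappa:\Theta\hookrightarrow\Gamma$ with $\hat\kappa\circ\iota=\kappa$ is the same for all embeddings $\kappa:\Delta\hookrightarrow\Gamma$. $\Gamma$ is $[a,b]$-regular if $\mathbb{T}$-regular for all types of order $(a,b)$; $(m,n)$-regular if $[a,b]$-regular for all $a\le m$, $a\le b\le n$. -}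

module Defs where

open import Data.Nat using (ℕ; zero; suc; _≤_; _∸_)
open import Data.Bool using (Bool; true; false; not; _∧_)
import Data.Bool.Properties as BoolP
open import Data.Fin using (Fin)
import Data.Fin as Fin
import Data.Fin.Properties as FinP
open import Data.Vec using (Vec; []; _∷_; lookup)
open import Data.List using (List; []; _∷_; length; concatMap; map; filterᵇ; allFin)
import Data.List as List
open import Relation.Binary.PropositionalEquality using (_≡_; refl; sym; trans)
open import Relation.Nullary using (¬_; Dec; does)
open import Relation.Nullary.Decidable using (_→-dec_; _×-dec_)
open import Data.Product using (_×_; _,_)
open import Function.Definitions using (Injective)

record Graph : Set where
  field
    n       : ℕ
    adj     : Fin n → Fin n → Bool
    adj-sym : ∀ i j → adj i j ≡ adj j i
    adj-irr : ∀ i → adj i i ≡ false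
open Graph public

record Embedding (Δ Γ : Graph) : Set where
  field
    fun  : Fin (n Δ) → Fin (n Γ)
    inj  : Injective _≡_ _≡_ fun
    pres : ∀ i j → adj Γ (fun i) (fun j) ≡ adj Δ i j
open Embedding public

record GraphType : Set where
  field
    Δ : Graph
    Θ : Graph
    ι : Embedding Δ Θ
open GraphType public

-- All maps Fin k → Fin N, represented as vectors (finitely many).
allVecs : (k N : ℕ) → List (Vec (Fin N) k)
allVecs zero    N = [] ∷ []
allVecs (suc k) N = concatMap (λ x → map (x ∷_) (allVecs k N)) (allFin N)

IsExtension : (T : GraphType) (Γ : Graph) → Embedding (Δ T) Γ →
              Vec (Fin (n Γ)) (n (Θ T)) → Set
IsExtension T Γ κ w =
  (∀ i j → lookup w i ≡ lookup w j → i ≡ j)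
  × (∀ i j → adj Γ (lookup w i) (lookup w j) ≡ adj (Θ T) i j)
  × (∀ i → lookup w (fun (ι T) i) ≡ fun κ i)

isExtension? : (T : GraphType) (Γ : Graph) (κ : Embedding (Δ T) Γ) →
               (w : Vec (Fin (n Γ)) (n (Θ T))) → Dec (IsExtension T Γ κ w)
isExtension? T Γ κ w =
  FinP.all? (λ i → FinP.all? (λ j → (lookup w i FinP.≟ lookup w j) →-dec (i FinP.≟ j)))
  ×-dec FinP.all? (λ i → FinP.all? (λ j → adj Γ (lookup w i) (lookup w j) BoolP.≟ adj (Θ T) i j))
  ×-dec FinP.all? (λ i → lookup w (fun (ι T) i) FinP.≟ fun κ i)

extCount : (T : GraphType) (Γ : Graph) → Embedding (Δ T) Γ → ℕ
extCount T Γ κ = length (List.filter (isExtension? T Γ κ) (allVecs (n (Θ T)) (n Γ)))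

TRegular : GraphType → Graph → Set
TRegular T Γ = ∀ (κ κ′ : Embedding (Δ T) Γ) → extCount T Γ κ ≡ extCount T Γ κ′

ABRegular : ℕ → ℕ → Graph → Set
ABRegular a b Γ = ∀ (T : GraphType) → n (Δ T) ≡ a → n (Θ T) ≡ b → TRegular T Γ

MNRegular : ℕ → ℕ → Graph → Set
MNRegular m k Γ = ∀ a b → a ≤ m → a ≤ b → b ≤ k → ABRegular a b Γ

-- Induced subgraph on a list of vertices (used with duplicate-free lists).
induced : (Γ : Graph) → List (Fin (n Γ)) → Graph
induced Γ l = record
  { n       = length l
  ; adj     = λ i j → adj Γ (List.lookup l i) (List.lookup l j)
  ; adj-sym = λ i j → adj-sym Γ (List.lookup l i) (List.lookup l j)
  ; adj-irr = λ i → adj-irr Γ (List.lookup l i)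
  }

Γ₁ : (Γ : Graph) → Fin (n Γ) → Graph
Γ₁ Γ v = induced Γ (filterᵇ (λ u → adj Γ v u) (allFin (n Γ)))

Γ₂ : (Γ : Graph) → Fin (n Γ) → Graph
Γ₂ Γ v = induced Γ (filterᵇ (λ u → not (adj Γ v u) ∧ not (does (u FinP.≟ v))) (allFin (n Γ)))

-- Write the layer Γ_c(v) for the set of vertices u ≠ v with adj v u = c, so Γ₁(v) = Γ_true(v) and
-- Γ₂(v) = Γ_false(v). The cone T^c of a type T = (Δ, ι, Θ) adds to Δ and Θ an apex joined (c = true) or
-- not joined (c = false) to every other vertex; it has order (a + 1, b + 1). An embedding κ of Δ into the
-- layer gives an embedding of Δ^c into Γ sending the apex to v, and the extensions of κ to Θ correspond
-- bijectively to the extensions of this embedding to Θ^c: such an extension sends the apex to v, hence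
-- by adjacency and injectivity all other vertices into the layer. So the two extension counts agree, and
-- T^c-regularity of Γ gives T-regularity of the layer.

module Submission where

open import Defs
open import Data.Bool using (Bool; true; false; not; _∧_; if_then_else_)
open import Data.Bool.ListAction using (all)
open import Data.Bool.Properties using (T-≡)
open import Data.Empty using (⊥-elim)
open import Data.Fin using (Fin; zero; suc)
import Data.Fin.Properties as FinP
open import Data.List using (List; []; _∷_; _++_; length; map; concatMap; filter; filterᵇ; allFin; tabulate)
import Data.List as List
import Data.List.Properties as ListP
open import Data.List.Membership.Propositional.Properties using (∈-lookup; ∈-filter⁻)
import Data.List.Relation.Unary.All as All
open import Data.List.Relation.Unary.AllPairs using (_∷_)
open import Data.List.Relation.Unary.Unique.Propositional using (Unique)
import Data.List.Relation.Unary.Unique.Propositional.Properties as UniqueP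
open import Data.Nat using (ℕ; zero; suc; _+_; _≤_; _∸_; s≤s)
open import Data.Nat.ListAction using (sum)
open import Data.Nat.Properties using (+-identityʳ)
open import Data.Product using (_×_; _,_; proj₁; proj₂)
open import Data.Vec using (Vec; []; _∷_)
import Data.Vec as Vec
import Data.Vec.Properties as VecP
open import Function using (_∘_; _⇔_; mk⇔; Equivalence)
open import Relation.Binary.PropositionalEquality
open import Relation.Nullary using (Dec; does; yes; no)
open import Relation.Nullary.Decidable using (T?; dec-false; does-⇔)

private
  variable
    A B : Set

count : (A → Bool) → List A → ℕ
count f []       = 0
count f (x ∷ xs) = if f x then suc (count f xs) else count f xs

count-cong : {f g : A → Bool} → (∀ x → f x ≡ g x) → ∀ xs → count f xs ≡ count g xs
count-cong f≗g []       = refl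
count-cong f≗g (x ∷ xs) = cong₂ (λ b k → if b then suc k else k) (f≗g x) (count-cong f≗g xs)

count-none : {f : A → Bool} → (∀ x → f x ≡ false) → ∀ xs → count f xs ≡ 0
count-none f≡false []       = refl
count-none f≡false (x ∷ xs) rewrite f≡false x = count-none f≡false xs

count-++ : (f : A → Bool) (xs ys : List A) → count f (xs ++ ys) ≡ count f xs + count f ys
count-++ f []       ys = refl
count-++ f (x ∷ xs) ys with f x
... | true  = cong suc (count-++ f xs ys)
... | false = count-++ f xs ys

count-map : (f : B → Bool) (h : A → B) (xs : List A) → count f (map h xs) ≡ count (f ∘ h) xs
count-map f h []       = refl
count-map f h (x ∷ xs) = cong (λ k → if f (h x) then suc k else k) (count-map f h xs)

count-concatMap : (f : B → Bool) (h : A → List B) (xs : List A) →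
                  count f (concatMap h xs) ≡ sum (map (count f ∘ h) xs)
count-concatMap f h []       = refl
count-concatMap f h (x ∷ xs) =
  trans (count-++ f (h x) (concatMap h xs)) (cong (count f (h x) +_) (count-concatMap f h xs))

length-filter≡count : {P : A → Set} (P? : ∀ x → Dec (P x)) (xs : List A) →
                      length (filter P? xs) ≡ count (does ∘ P?) xs
length-filter≡count P? []       = refl
length-filter≡count P? (x ∷ xs) with does (P? x)
... | true  = cong suc (length-filter≡count P? xs)
... | false = length-filter≡count P? xs

sum-tabulate-zero : ∀ {N} (F : Fin N → ℕ) → (∀ x → F x ≡ 0) → sum (tabulate F) ≡ 0
sum-tabulate-zero {zero}  F F≡0 = refl
sum-tabulate-zero {suc N} F F≡0 rewrite F≡0 zero = sum-tabulate-zero (F ∘ suc) (F≡0 ∘ suc)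

sum-tabulate-point : ∀ {N} (F : Fin N → ℕ) (v : Fin N) → (∀ x → x ≢ v → F x ≡ 0) →
                     sum (tabulate F) ≡ F v
sum-tabulate-point {suc N} F zero    F≡0 =
  trans (cong (F zero +_) (sum-tabulate-zero (F ∘ suc) (λ x → F≡0 (suc x) λ ())))
        (+-identityʳ (F zero))
sum-tabulate-point {suc N} F (suc v) F≡0 rewrite F≡0 zero (λ ()) =
  sum-tabulate-point (F ∘ suc) v (λ x x≢v → F≡0 (suc x) (x≢v ∘ FinP.suc-injective))

sum-map-filterᵇ : (H : A → ℕ) (p : A → Bool) (xs : List A) →
                  sum (map H (filterᵇ p xs)) ≡ sum (map (λ x → if p x then H x else 0) xs)
sum-map-filterᵇ H p []       = refl
sum-map-filterᵇ H p (x ∷ xs) with p x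
... | true  = cong (H x +_) (sum-map-filterᵇ H p xs)
... | false = sum-map-filterᵇ H p xs

map-lookup-allFin : (xs : List A) → map (List.lookup xs) (allFin (length xs)) ≡ xs
map-lookup-allFin xs = trans (ListP.map-tabulate (λ i → i) (List.lookup xs)) (ListP.tabulate-lookup xs)

Unique⇒lookup-injective : {xs : List A} → Unique xs →
                          ∀ i j → List.lookup xs i ≡ List.lookup xs j → i ≡ j
Unique⇒lookup-injective {xs = x ∷ xs} _          zero    zero    _  = refl
Unique⇒lookup-injective {xs = x ∷ xs} (x∉ ∷ _)   zero    (suc j) eq =
  ⊥-elim (All.lookup x∉ (∈-lookup j) eq)
Unique⇒lookup-injective {xs = x ∷ xs} (x∉ ∷ _)   (suc i) zero    eq =
  ⊥-elim (All.lookup x∉ (∈-lookup i) (sym eq))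
Unique⇒lookup-injective {xs = x ∷ xs} (_ ∷ uniq) (suc i) (suc j) eq =
  cong suc (Unique⇒lookup-injective uniq i j eq)

count-allVecs-suc : ∀ {b N} (g : Vec (Fin N) (suc b) → Bool) →
                    count g (allVecs (suc b) N)
                      ≡ sum (map (λ x → count (g ∘ (x ∷_)) (allVecs b N)) (allFin N))
count-allVecs-suc {b} {N} g =
  trans (count-concatMap g (λ x → map (x ∷_) (allVecs b N)) (allFin N))
        (cong sum (ListP.map-cong (λ x → count-map g (x ∷_) (allVecs b N)) (allFin N)))

count-allVecs-head : ∀ {b N} (g : Vec (Fin N) (suc b) → Bool) (v : Fin N) →
                     (∀ x → x ≢ v → ∀ w → g (x ∷ w) ≡ false) →
                     count g (allVecs (suc b) N) ≡ count (g ∘ (v ∷_)) (allVecs b N)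
count-allVecs-head {b} {N} g v off-v =
  trans (count-allVecs-suc g)
        (trans (cong sum (ListP.map-tabulate (λ x → x) (λ x → count (g ∘ (x ∷_)) (allVecs b N))))
               (sum-tabulate-point _ v (λ x x≢v → count-none (off-v x x≢v) (allVecs b N))))

module _ {N : ℕ} (p : Fin N → Bool) where

  private
    L : List (Fin N)
    L = filterᵇ p (allFin N)

  count-allVecs-lookup : ∀ b (g : Vec (Fin N) b → Bool) →
    count (g ∘ Vec.map (List.lookup L)) (allVecs b (length L))
      ≡ count (λ w → all p (Vec.toList w) ∧ g w) (allVecs b N)
  count-allVecs-lookup zero    g = refl
  count-allVecs-lookup (suc b) g = begin
    count (g ∘ Vec.map σ) (allVecs (suc b) (length L))
      ≡⟨ count-allVecs-suc (g ∘ Vec.map σ) ⟩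
    sum (map (λ i → count (g ∘ (σ i ∷_) ∘ Vec.map σ) (allVecs b (length L))) (allFin (length L)))
      ≡⟨ cong sum (ListP.map-cong (λ i → count-allVecs-lookup b (g ∘ (σ i ∷_))) (allFin _)) ⟩
    sum (map (H ∘ σ) (allFin (length L)))
      ≡⟨ cong sum (trans (ListP.map-∘ (allFin (length L))) (cong (map H) (map-lookup-allFin L))) ⟩
    sum (map H L)
      ≡⟨ sum-map-filterᵇ H p (allFin N) ⟩
    sum (map (λ x → if p x then H x else 0) (allFin N))
      ≡⟨ cong sum (ListP.map-cong guard-head (allFin N)) ⟩
    sum (map (λ x → count (λ w → all p (Vec.toList (x ∷ w)) ∧ g (x ∷ w)) (allVecs b N)) (allFin N))
      ≡⟨ count-allVecs-suc (λ w → all p (Vec.toList w) ∧ g w) ⟨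
    count (λ w → all p (Vec.toList w) ∧ g w) (allVecs (suc b) N)
      ∎
    where
    open ≡-Reasoning
    σ : Fin (length L) → Fin N
    σ = List.lookup L
    H : Fin N → ℕ
    H x = count (λ w → all p (Vec.toList w) ∧ g (x ∷ w)) (allVecs b N)
    guard-head : ∀ x → (if p x then H x else 0)
                     ≡ count (λ w → (p x ∧ all p (Vec.toList w)) ∧ g (x ∷ w)) (allVecs b N)
    guard-head x with p x
    ... | true  = refl
    ... | false = sym (count-none (λ _ → refl) (allVecs b N))

module _ (c : Bool) where

  cone : Graph → Graph
  cone G = record { n = suc (n G) ; adj = coneAdj ; adj-sym = coneAdj-sym ; adj-irr = coneAdj-irr }
    where
    coneAdj : Fin (suc (n G)) → Fin (suc (n G)) → Bool
    coneAdj zero    zero    = false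
    coneAdj zero    (suc j) = c
    coneAdj (suc i) zero    = c
    coneAdj (suc i) (suc j) = adj G i j
    coneAdj-sym : ∀ i j → coneAdj i j ≡ coneAdj j i
    coneAdj-sym zero    zero    = refl
    coneAdj-sym zero    (suc j) = refl
    coneAdj-sym (suc i) zero    = refl
    coneAdj-sym (suc i) (suc j) = adj-sym G i j
    coneAdj-irr : ∀ i → coneAdj i i ≡ false
    coneAdj-irr zero    = refl
    coneAdj-irr (suc i) = adj-irr G i

  coneEmbedding : {G H : Graph} → Embedding G H → Embedding (cone G) (cone H)
  coneEmbedding {G} {H} e = record { fun = f ; inj = f-injective ; pres = f-pres }
    where
    f : Fin (suc (n G)) → Fin (suc (n H))
    f zero    = zero
    f (suc i) = suc (fun e i)
    f-injective : ∀ {i j} → f i ≡ f j → i ≡ j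
    f-injective {zero}  {zero}  _  = refl
    f-injective {suc i} {suc j} eq = cong suc (inj e (FinP.suc-injective eq))
    f-pres : ∀ i j → adj (cone H) (f i) (f j) ≡ adj (cone G) i j
    f-pres zero    zero    = refl
    f-pres zero    (suc j) = refl
    f-pres (suc i) zero    = refl
    f-pres (suc i) (suc j) = pres e i j

  coneType : GraphType → GraphType
  coneType T = record { Δ = cone (Δ T) ; Θ = cone (Θ T) ; ι = coneEmbedding (ι T) }

extCount-cong : (T : GraphType) (G : Graph) (κ κ′ : Embedding (Δ T) G) →
                (∀ i → fun κ i ≡ fun κ′ i) → extCount T G κ ≡ extCount T G κ′
extCount-cong T G κ κ′ κ≗κ′ = begin
  extCount T G κ                          ≡⟨ length-filter≡count (isExtension? T G κ) vecs ⟩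
  count (does ∘ isExtension? T G κ) vecs  ≡⟨ count-cong same-extensions vecs ⟩
  count (does ∘ isExtension? T G κ′) vecs ≡⟨ length-filter≡count (isExtension? T G κ′) vecs ⟨
  extCount T G κ′                         ∎
  where
  open ≡-Reasoning
  vecs : List (Vec (Fin (n G)) (n (Θ T)))
  vecs = allVecs (n (Θ T)) (n G)
  same-extensions : ∀ w → does (isExtension? T G κ w) ≡ does (isExtension? T G κ′ w)
  same-extensions w = does-⇔
    (mk⇔ (λ (inj , pres , ext) → inj , pres , λ i → trans (ext i) (κ≗κ′ i))
         (λ (inj , pres , ext) → inj , pres , λ i → trans (ext i) (sym (κ≗κ′ i))))
    (isExtension? T G κ w) (isExtension? T G κ′ w)

TRegular-empty : (T : GraphType) (G : Graph) → n (Δ T) ≡ 0 → TRegular T G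
TRegular-empty T G |Δ|≡0 κ κ′ =
  extCount-cong T G κ κ′ (λ i → ⊥-elim (FinP.¬Fin0 (subst Fin |Δ|≡0 i)))

module Layer (Γ : Graph) (v : Fin (n Γ)) (c : Bool) (p : Fin (n Γ) → Bool)
  (p-sound    : ∀ {u} → p u ≡ true → adj Γ v u ≡ c × u ≢ v)
  (p-complete : ∀ {u} → adj Γ v u ≡ c → u ≢ v → p u ≡ true) where

  L : List (Fin (n Γ))
  L = filterᵇ p (allFin (n Γ))

  layer : Graph
  layer = induced Γ L

  σ : Fin (n layer) → Fin (n Γ)
  σ = List.lookup L

  σ-injective : ∀ {i j} → σ i ≡ σ j → i ≡ j
  σ-injective = Unique⇒lookup-injective (UniqueP.filter⁺ (T? ∘ p) (UniqueP.allFin⁺ (n Γ))) _ _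

  p-σ : ∀ i → p (σ i) ≡ true
  p-σ i = Equivalence.to T-≡ (proj₂ (∈-filter⁻ (T? ∘ p) {xs = allFin (n Γ)} (∈-lookup i)))

  adj-v-σ : ∀ i → adj Γ v (σ i) ≡ c
  adj-v-σ i = proj₁ (p-sound (p-σ i))

  adj-σ-v : ∀ i → adj Γ (σ i) v ≡ c
  adj-σ-v i = trans (adj-sym Γ (σ i) v) (adj-v-σ i)

  σ≢v : ∀ i → σ i ≢ v
  σ≢v i = proj₂ (p-sound (p-σ i))

  module _ (T : GraphType) (κ : Embedding (Δ T) layer) where

    coneAt : Embedding (cone c (Δ T)) Γ
    coneAt = record { fun = f ; inj = f-injective ; pres = f-pres }
      where
      f : Fin (suc (n (Δ T))) → Fin (n Γ)
      f zero    = v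
      f (suc i) = σ (fun κ i)
      f-injective : ∀ {i j} → f i ≡ f j → i ≡ j
      f-injective {zero}  {zero}  _  = refl
      f-injective {zero}  {suc j} eq = ⊥-elim (σ≢v _ (sym eq))
      f-injective {suc i} {zero}  eq = ⊥-elim (σ≢v _ eq)
      f-injective {suc i} {suc j} eq = cong suc (inj κ (σ-injective eq))
      f-pres : ∀ i j → adj Γ (f i) (f j) ≡ adj (cone c (Δ T)) i j
      f-pres zero    zero    = adj-irr Γ v
      f-pres zero    (suc j) = adj-v-σ _
      f-pres (suc i) zero    = adj-σ-v _
      f-pres (suc i) (suc j) = pres κ i j

    private
      Extends : Vec (Fin (n layer)) (n (Θ T)) → Set
      Extends = IsExtension T layer κ
      Extends⁺ : Vec (Fin (n Γ)) (suc (n (Θ T))) → Set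
      Extends⁺ = IsExtension (coneType c T) Γ coneAt

    extends⇔extends⁺ : (w : Vec (Fin (n layer)) (n (Θ T))) → Extends w ⇔ Extends⁺ (v ∷ Vec.map σ w)
    extends⇔extends⁺ w = mk⇔ to from
      where
      σw : ∀ i → Vec.lookup (Vec.map σ w) i ≡ σ (Vec.lookup w i)
      σw i = VecP.lookup-map i σ w

      to : Extends w → Extends⁺ (v ∷ Vec.map σ w)
      to (w-inj , w-pres , w-ext) = w⁺-inj , w⁺-pres , w⁺-ext
        where
        w⁺-inj : ∀ i j → Vec.lookup (v ∷ Vec.map σ w) i ≡ Vec.lookup (v ∷ Vec.map σ w) j → i ≡ j
        w⁺-inj zero    zero    _  = refl
        w⁺-inj zero    (suc j) eq = ⊥-elim (σ≢v _ (sym (trans eq (σw j))))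
        w⁺-inj (suc i) zero    eq = ⊥-elim (σ≢v _ (trans (sym (σw i)) eq))
        w⁺-inj (suc i) (suc j) eq =
          cong suc (w-inj i j (σ-injective (trans (sym (σw i)) (trans eq (σw j)))))
        w⁺-pres : ∀ i j → adj Γ (Vec.lookup (v ∷ Vec.map σ w) i) (Vec.lookup (v ∷ Vec.map σ w) j)
                            ≡ adj (cone c (Θ T)) i j
        w⁺-pres zero    zero    = adj-irr Γ v
        w⁺-pres zero    (suc j) rewrite σw j = adj-v-σ _
        w⁺-pres (suc i) zero    rewrite σw i = adj-σ-v _
        w⁺-pres (suc i) (suc j) rewrite σw i | σw j = w-pres i j
        w⁺-ext : ∀ i → Vec.lookup (v ∷ Vec.map σ w) (fun (coneEmbedding c (ι T)) i) ≡ fun coneAt i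
        w⁺-ext zero    = refl
        w⁺-ext (suc i) = trans (σw _) (cong σ (w-ext i))

      from : Extends⁺ (v ∷ Vec.map σ w) → Extends w
      from (w⁺-inj , w⁺-pres , w⁺-ext) = w-inj , w-pres , w-ext
        where
        w-inj : ∀ i j → Vec.lookup w i ≡ Vec.lookup w j → i ≡ j
        w-inj i j eq =
          FinP.suc-injective (w⁺-inj (suc i) (suc j) (trans (σw i) (trans (cong σ eq) (sym (σw j)))))
        w-pres : ∀ i j → adj layer (Vec.lookup w i) (Vec.lookup w j) ≡ adj (Θ T) i j
        w-pres i j = trans (cong₂ (adj Γ) (sym (σw i)) (sym (σw j))) (w⁺-pres (suc i) (suc j))
        w-ext : ∀ i → Vec.lookup w (fun (ι T) i) ≡ fun κ i
        w-ext i = σ-injective (trans (sym (σw _)) (w⁺-ext (suc i)))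

    extension⁺-head : ∀ {x w} → Extends⁺ (x ∷ w) → x ≡ v
    extension⁺-head (_ , _ , ext) = ext zero

    extension⁺-tail : ∀ {w} → Extends⁺ (v ∷ w) → all p (Vec.toList w) ≡ true
    extension⁺-tail {w} (inj⁺ , pres⁺ , _) =
      all-p w (λ i → pres⁺ zero (suc i)) (λ i eq → suc≢zero (inj⁺ (suc i) zero eq))
      where
      suc≢zero : ∀ {b} {i : Fin b} → suc i ≢ zero
      suc≢zero ()
      all-p : ∀ {b} (u : Vec (Fin (n Γ)) b) → (∀ i → adj Γ v (Vec.lookup u i) ≡ c) →
              (∀ i → Vec.lookup u i ≢ v) → all p (Vec.toList u) ≡ true
      all-p []      _     _   = refl
      all-p (x ∷ u) adj≡c ≢v rewrite p-complete (adj≡c zero) (≢v zero) =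
        all-p u (adj≡c ∘ suc) (≢v ∘ suc)

    extCount-coneAt : extCount T layer κ ≡ extCount (coneType c T) Γ coneAt
    extCount-coneAt = begin
      extCount T layer κ
        ≡⟨ length-filter≡count Ext? (allVecs b (n layer)) ⟩
      count (does ∘ Ext?) (allVecs b (n layer))
        ≡⟨ count-cong (λ w → does-⇔ (extends⇔extends⁺ w) (Ext? w) (Ext⁺? (v ∷ Vec.map σ w)))
                      (allVecs b (n layer)) ⟩
      count (E ∘ (v ∷_) ∘ Vec.map σ) (allVecs b (n layer))
        ≡⟨ count-allVecs-lookup p b (E ∘ (v ∷_)) ⟩
      count (λ w → all p (Vec.toList w) ∧ E (v ∷ w)) (allVecs b (n Γ))
        ≡⟨ count-cong (λ w → E-tail w (Ext⁺? (v ∷ w))) (allVecs b (n Γ)) ⟨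
      count (E ∘ (v ∷_)) (allVecs b (n Γ))
        ≡⟨ count-allVecs-head E v E-head ⟨
      count E (allVecs (suc b) (n Γ))
        ≡⟨ length-filter≡count Ext⁺? (allVecs (suc b) (n Γ)) ⟨
      extCount (coneType c T) Γ coneAt
        ∎
      where
      open ≡-Reasoning
      b : ℕ
      b = n (Θ T)
      Ext? : ∀ w → Dec (Extends w)
      Ext? = isExtension? T layer κ
      Ext⁺? : ∀ w → Dec (Extends⁺ w)
      Ext⁺? = isExtension? (coneType c T) Γ coneAt
      E : Vec (Fin (n Γ)) (suc b) → Bool
      E = does ∘ Ext⁺?
      E-head : ∀ x → x ≢ v → ∀ w → E (x ∷ w) ≡ false
      E-head x x≢v w = dec-false (Ext⁺? (x ∷ w)) (x≢v ∘ extension⁺-head)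
      E-tail : ∀ w (d : Dec (Extends⁺ (v ∷ w))) → does d ≡ all p (Vec.toList w) ∧ does d
      E-tail w (yes ext) rewrite extension⁺-tail ext = refl
      E-tail w (no _) with all p (Vec.toList w)
      ... | true  = refl
      ... | false = refl

  TRegular-layer : (T : GraphType) → TRegular (coneType c T) Γ → TRegular T layer
  TRegular-layer T reg κ κ′ =
    trans (extCount-coneAt T κ) (trans (reg (coneAt T κ) (coneAt T κ′)) (sym (extCount-coneAt T κ′)))

  MNRegular-layer : ∀ {m k} → 1 ≤ m → MNRegular m k Γ → MNRegular (m ∸ 1) (k ∸ 1) layer
  -- For k = 0 the truncated k ∸ 1 is 0, so only the type of order (0, 0) must be handled, and it is trivial.
  MNRegular-layer {suc m} {zero}  _ _   zero zero _ _ _ T |Δ| _ = TRegular-empty T layer |Δ|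
  MNRegular-layer {suc m} {suc k} _ reg a b a≤m a≤b b≤k T |Δ| |Θ| =
    TRegular-layer T
      (reg (suc a) (suc b) (s≤s a≤m) (s≤s a≤b) (s≤s b≤k) (coneType c T) (cong suc |Δ|) (cong suc |Θ|))

mainTheorem10 : (m k : ℕ) (Γ : Graph) → 1 ≤ m → MNRegular m k Γ →
    (v : Fin (n Γ)) → MNRegular (m ∸ 1) (k ∸ 1) (Γ₁ Γ v) × MNRegular (m ∸ 1) (k ∸ 1) (Γ₂ Γ v)
mainTheorem10 m k Γ 1≤m reg v =
  Layer.MNRegular-layer Γ v true (adj Γ v)
    (λ adj≡true → adj≡true , adjacent≢v adj≡true) (λ adj≡true _ → adj≡true) 1≤m reg ,
  Layer.MNRegular-layer Γ v false non-neighbour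
    non-neighbour-sound non-neighbour-complete 1≤m reg
  where
  adjacent≢v : ∀ {u} → adj Γ v u ≡ true → u ≢ v
  adjacent≢v adj≡true refl with trans (sym adj≡true) (adj-irr Γ v)
  ... | ()

  non-neighbour : Fin (n Γ) → Bool
  non-neighbour u = not (adj Γ v u) ∧ not (does (u FinP.≟ v))

  non-neighbour-sound : ∀ {u} → non-neighbour u ≡ true → adj Γ v u ≡ false × u ≢ v
  non-neighbour-sound {u} _ with adj Γ v u | u FinP.≟ v
  non-neighbour-sound     _ | false | no u≢v = refl , u≢v

  non-neighbour-complete : ∀ {u} → adj Γ v u ≡ false → u ≢ v → non-neighbour u ≡ true
  non-neighbour-complete {u} adj≡false u≢v rewrite adj≡false | dec-false (u FinP.≟ v) u≢v = refl
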